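{- Let $q$ be a prime power, let $n$ be a positive integer, let $a,b\in\mathbb{F}_q$ with $a\neq 0$, and let $f(X)=aX^n+b$. Then (1) $S(f)=a+2b$ if $(q-1)\mid n$; (2) $S(f)=b\cdot\bigl(1-\frac{1}{\gcd(n,q-1)}\bigr)$ if $(q-1)\nmid n$.
   Context: For $f(X)\in\mathbb{F}_q[X]$, $S(f)$ denotes the sum of the elements of the value set $f(\mathbb{F}_q)=\{f(x):x\in\mathbb{F}_q\}$ (each value counted once). Integers are interpreted in $\mathbb{F}_q$. -}

module Defs where

open import Level using (0ℓ)
open import Data.Nat using (ℕ; zero; suc)
open import Data.Fin using (Fin)
open import Data.List using (List; map; foldr; allFin; deduplicate)
open import Relation.Nullary using (¬_; Dec)
open import Relation.Binary.PropositionalEquality using (_≡_)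
open import Algebra.Structures using (IsCommutativeRing)
open import Function.Bundles using (_↔_; Inverse)

-- The multiplicative inverse is a total function; only its value on
-- nonzero elements is constrained (x ≢ 0 → x * x⁻¹ ≡ 1).
record FiniteField : Set₁ where
  infixl 6 _+_
  infixl 7 _*_
  infixl 6 _-_
  infix 8 -_
  infix 9 _⁻¹
  field
    Carrier : Set
    _+_ _*_ : Carrier → Carrier → Carrier
    -_ : Carrier → Carrier
    0# 1# : Carrier
    _⁻¹ : Carrier → Carrier
    isCommutativeRing : IsCommutativeRing _≡_ _+_ _*_ -_ 0# 1#
    0≢1 : ¬ (0# ≡ 1#)
    inverse : ∀ x → ¬ (x ≡ 0#) → x * (x ⁻¹) ≡ 1#
    _≟_ : (x y : Carrier) → Dec (x ≡ y)
    q : ℕ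
    enum : Fin q ↔ Carrier

  _-_ : Carrier → Carrier → Carrier
  x - y = x + (- y)

  _^_ : Carrier → ℕ → Carrier
  x ^ zero = 1#
  x ^ suc n = x * (x ^ n)

  ι : ℕ → Carrier
  ι zero = 0#
  ι (suc n) = 1# + ι n

  elements : List Carrier
  elements = map (Inverse.to enum) (allFin q)

  valueSet : (Carrier → Carrier) → List Carrier
  valueSet f = deduplicate _≟_ (map f elements)

  S : (Carrier → Carrier) → Carrier
  S f = foldr _+_ 0# (valueSet f)

{-# OPTIONS --safe #-}
-- Write N = q - 1 = |F*|, d = gcd(n, N) and N = m d. The values x ^ n with x ≠ 0 are m-th roots
-- of unity (x ^ (n m) is a power of x ^ N = 1), and X ^ m - 1 has at most m roots; conversely each
-- fibre of x ↦ x ^ n lies in a coset of the at most d roots of X ^ d - 1, so there are at least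
-- N / d = m values. Hence they are exactly the m-th roots of unity, a group, and multiplying it by
-- one of its elements h ≠ 1 permutes it, so its sum is 0 unless m = 1, i.e. unless N ∣ n. The value
-- set of a X ^ n + b consists of b and the a y + b for these y, with sum b + a ∑ y + m b, and
-- m = - 1 / d in F because m d = N = - 1.
module Submission where

open import Defs
open import Data.Nat using (ℕ; suc; _∸_; NonZero)
open import Data.Nat.Divisibility using (_∣_)
open import Data.Nat.GCD using (gcd)
open import Relation.Nullary using (¬_)
open import Relation.Binary.PropositionalEquality using (_≡_)
open import Data.Product using (_×_)

open import Level using (0ℓ)
open import Algebra.Bundles using (CommutativeRing)
open import Algebra.Core using (Op₁; Op₂)
open import Algebra.Structures using (IsCommutativeRing)
import Algebra.Properties.CommutativeSemiring.Exp as ExpProperties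
import Algebra.Properties.Group as GroupProperties
import Algebra.Properties.Ring as RingProperties
import Algebra.Properties.Semiring.Mult as MultProperties
import Algebra.Solver.Ring.NaturalCoefficients as NaturalCoefficientsSolver
open import Data.Empty using (⊥-elim)
open import Data.List using (List; []; _∷_; map; foldr; length; filter; allFin; deduplicate)
open import Data.List.Properties using (length-map; length-tabulate)
open import Data.List.Membership.Propositional using (_∈_)
open import Data.List.Membership.Propositional.Properties
  using (∈-map⁺; ∈-map⁻; ∈-allFin; ∈-filter⁺; ∈-filter⁻; ∈-length; ∈-deduplicate⁺; ∈-deduplicate⁻)
open import Data.List.Membership.Propositional.Properties.WithK using (unique∧set⇒bag)
open import Data.List.Relation.Binary.BagAndSetEquality using (∼bag⇒↭)
open import Data.List.Relation.Binary.Permutation.Propositional using (_↭_; ↭⇒↭ₛ)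
open import Data.List.Relation.Binary.Permutation.Propositional.Properties using (↭-length)
open import Data.List.Relation.Binary.Permutation.Setoid.Properties using (foldr-commMonoid)
open import Data.List.Relation.Unary.All as All using (All; []; _∷_)
import Data.List.Relation.Unary.All.Properties as All
open import Data.List.Relation.Unary.Any using (here; there)
open import Data.List.Relation.Unary.Unique.Propositional using (Unique; []; _∷_)
import Data.List.Relation.Unary.Unique.Propositional.Properties as Unique
open import Data.List.Relation.Unary.Unique.DecPropositional.Properties using (deduplicate-!)
open import Data.Maybe using (nothing)
open import Data.Nat as ℕ using (zero; _≤_; z≤n; s≤s; >-nonZero; ≢-nonZero; ≢-nonZero⁻¹)
import Data.Nat.Properties as ℕ
open import Data.Nat.GCD using (gcd-GCD; gcd[m,n]∣m; gcd[m,n]∣n; gcd[m,n]≢0; module Bézout)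
open import Data.Product using (_,_; ∃; proj₂)
open import Data.Sum using (_⊎_; inj₁; inj₂; [_,_])
open import Function.Base using (id)
open import Function.Bundles using (_⇔_; mk⇔; Inverse; Injection)
open import Function.Properties.Inverse using (↔⇒↣)
open import Relation.Binary.Definitions using (DecidableEquality)
open import Relation.Binary.PropositionalEquality
  using (_≢_; refl; sym; trans; cong; cong₂; subst; setoid; module ≡-Reasoning)
open import Relation.Nullary using (yes; no)
open import Relation.Nullary.Decidable using (¬?)
open import Relation.Unary using (Pred; Decidable)
open import Relation.Unary.Properties using (∁?)

module _ {A : Set} where

  unique∧set⇒↭ : {xs ys : List A} → Unique xs → Unique ys → (∀ {z} → z ∈ xs ⇔ z ∈ ys) → xs ↭ ys
  unique∧set⇒↭ u v xs⇔ys = ∼bag⇒↭ (unique∧set⇒bag u v xs⇔ys)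

  map-bijection-↭ : ∀ {xs} (g h : A → A) → (∀ x → h (g x) ≡ x) → (∀ y → g (h y) ≡ y) →
                    (∀ {x} → x ∈ xs → g x ∈ xs) → (∀ {y} → y ∈ xs → h y ∈ xs) →
                    Unique xs → map g xs ↭ xs
  map-bijection-↭ {xs} g h hg≗id gh≗id g-closed h-closed u =
    unique∧set⇒↭ (Unique.map⁺ g-injective u) u (mk⇔ to from)
    where
    g-injective : ∀ {x y} → g x ≡ g y → x ≡ y
    g-injective {x} {y} gx≡gy = trans (sym (hg≗id x)) (trans (cong h gx≡gy) (hg≗id y))
    to : ∀ {z} → z ∈ map g xs → z ∈ xs
    to z∈ with ∈-map⁻ g z∈
    ... | _ , x∈xs , refl = g-closed x∈xs
    from : ∀ {z} → z ∈ xs → z ∈ map g xs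
    from {z} z∈xs = subst (_∈ map g xs) (gh≗id z) (∈-map⁺ g (h-closed z∈xs))

  ∃-∈-≢ : DecidableEquality A → ∀ {xs} (y : A) → Unique xs → 2 ≤ length xs → ∃ λ z → z ∈ xs × z ≢ y
  ∃-∈-≢ _≟_ {[]} _ _ ()
  ∃-∈-≢ _≟_ {_ ∷ []} _ _ (s≤s ())
  ∃-∈-≢ _≟_ {x₁ ∷ x₂ ∷ _} y ((x₁≢x₂ ∷ _) ∷ _) _ with x₁ ≟ y
  ... | yes refl = x₂ , there (here refl) , λ x₂≡x₁ → x₁≢x₂ (sym x₂≡x₁)
  ... | no x₁≢y = x₁ , here refl , x₁≢y

  length-filter+∁ : ∀ {P : Pred A 0ℓ} (P? : Decidable P) xs →
                    length (filter P? xs) ℕ.+ length (filter (∁? P?) xs) ≡ length xs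
  length-filter+∁ P? [] = refl
  length-filter+∁ P? (x ∷ xs) with P? x
  ... | yes _ = cong suc (length-filter+∁ P? xs)
  ... | no _ = trans (ℕ.+-suc _ _) (cong suc (length-filter+∁ P? xs))

module _ {A B : Set} (_≟_ : DecidableEquality B) (g : A → B) {P : Pred A 0ℓ} (d : ℕ)
  (fibre-bound : ∀ y {E} → Unique E → All P E → All (λ x → g x ≡ y) E → length E ≤ d) where

  length≤fibres : ∀ J {D} → Unique D → All P D → All (λ x → g x ∈ J) D → length D ≤ length J ℕ.* d
  length≤fibres [] {[]} _ _ _ = z≤n
  length≤fibres [] {_ ∷ _} _ _ (() ∷ _)
  length≤fibres (y ∷ J) {D} u PD gD∈ = subst (_≤ length (y ∷ J) ℕ.* d) (length-filter+∁ over-y? D)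
    (ℕ.+-mono-≤ (fibre-bound y (Unique.filter⁺ over-y? u) (All.filter⁺ over-y? PD) (All.all-filter over-y? D))
      (length≤fibres J (Unique.filter⁺ (∁? over-y?) u) (All.filter⁺ (∁? over-y?) PD)
        (All.zipWith drop-y (All.filter⁺ (∁? over-y?) gD∈ , All.all-filter (∁? over-y?) D))))
    where
    over-y? : Decidable (λ x → g x ≡ y)
    over-y? x = g x ≟ y
    drop-y : ∀ {x} → g x ∈ y ∷ J × g x ≢ y → g x ∈ J
    drop-y (here gx≡y , gx≢y) = ⊥-elim (gx≢y gx≡y)
    drop-y (there gx∈J , _) = gx∈J

module Polynomial {A : Set} {add mul : Op₂ A} {neg : Op₁ A} {0ᴬ 1ᴬ : A}
  (isCommutativeRing : IsCommutativeRing _≡_ add mul neg 0ᴬ 1ᴬ)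
  (noZeroDivisors : ∀ {x y} → mul x y ≡ 0ᴬ → x ≡ 0ᴬ ⊎ y ≡ 0ᴬ) where

  private
    R : CommutativeRing 0ℓ 0ℓ
    R = record { isCommutativeRing = isCommutativeRing }
    open CommutativeRing R using (_+_; _*_; 0#; +-identityʳ; zeroʳ; +-group; commutativeSemiring; ring)
    open GroupProperties +-group using (x∙y⁻¹≈ε⇒x≈y; x≈y⇒x∙y⁻¹≈ε) renaming (∙-cancelˡ to +-cancelˡ)
    open RingProperties ring using ([y-z]x≈yx-zx)
    open NaturalCoefficientsSolver commutativeSemiring (λ _ _ → nothing) using (solve; _:=_; _:+_; _:*_)
    open ≡-Reasoning

  -- coefficient lists, constant term first
  eval : List A → A → A
  eval [] x = 0#
  eval (c ∷ cs) x = c + x * eval cs x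

  quotient : A → List A → List A
  quotient r [] = []
  quotient r (c ∷ cs) = eval (c ∷ cs) r ∷ quotient r cs

  length-quotient : ∀ r cs → length (quotient r cs) ≡ length cs
  length-quotient r [] = refl
  length-quotient r (c ∷ cs) = cong suc (length-quotient r cs)

  -- x·p(x) - r·p(r) = (x - r)·q(x) for q = quotient r p, rearranged so that no subtraction occurs
  *-eval-quotient : ∀ r cs x → x * eval cs x + r * eval (quotient r cs) x ≡ r * eval cs r + x * eval (quotient r cs) x
  *-eval-quotient r [] x = trans (cong₂ _+_ (zeroʳ x) (zeroʳ r)) (sym (cong₂ _+_ (zeroʳ r) (zeroʳ x)))
  *-eval-quotient r (c ∷ cs) x = begin
    x * (c + x * p[x]) + r * (p[r] + x * q[x])
      ≡⟨ solve 6 (λ x r c p[x] p[r] q[x] → x :* (c :+ x :* p[x]) :+ r :* (p[r] :+ x :* q[x])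
                                          := r :* p[r] :+ x :* c :+ x :* (x :* p[x] :+ r :* q[x]))
               refl x r c p[x] p[r] q[x] ⟩
    r * p[r] + x * c + x * (x * p[x] + r * q[x])
      ≡⟨ cong (λ t → r * p[r] + x * c + x * t) (*-eval-quotient r cs x) ⟩
    r * p[r] + x * c + x * (r * eval cs r + x * q[x])
      ≡⟨ solve 6 (λ x r c p[r] q[x] e → r :* p[r] :+ x :* c :+ x :* (r :* e :+ x :* q[x])
                                       := r :* p[r] :+ x :* (c :+ r :* e :+ x :* q[x]))
               refl x r c p[r] q[x] (eval cs r) ⟩
    r * p[r] + x * (p[r] + x * q[x]) ∎
    where
    p[x] = eval cs x
    p[r] = eval (c ∷ cs) r
    q[x] = eval (quotient r cs) x

  *-cancelʳ-≢ : ∀ {u v w} → u * w ≡ v * w → u ≢ v → w ≡ 0#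
  *-cancelʳ-≢ {u} {v} {w} uw≡vw u≢v with noZeroDivisors (trans ([y-z]x≈yx-zx w u v) (x≈y⇒x∙y⁻¹≈ε uw≡vw))
  ... | inj₁ u-v≡0 = ⊥-elim (u≢v (x∙y⁻¹≈ε⇒x≈y u v u-v≡0))
  ... | inj₂ w≡0 = w≡0

  quotient-root : ∀ {r c cs t} → eval (c ∷ cs) r ≡ 0# → eval (c ∷ cs) t ≡ 0# → r ≢ t →
                  eval (quotient r cs) t ≡ 0#
  quotient-root {r} {c} {cs} {t} p[r]≡0 p[t]≡0 r≢t = *-cancelʳ-≢ (+-cancelˡ (r * eval cs r) _ _ (begin
    r * eval cs r + r * q[t]  ≡⟨ cong (_+ r * q[t]) (+-cancelˡ c _ _ (trans p[r]≡0 (sym p[t]≡0))) ⟩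
    t * eval cs t + r * q[t]  ≡⟨ *-eval-quotient r cs t ⟩
    r * eval cs r + t * q[t]  ∎)) r≢t
    where q[t] = eval (quotient r cs) t

  vanishes-everywhere : ∀ cs rs → Unique rs → All (λ r → eval cs r ≡ 0#) rs → length cs ≤ length rs →
                        ∀ x → eval cs x ≡ 0#
  vanishes-everywhere [] _ _ _ _ x = refl
  vanishes-everywhere (c ∷ cs) (r ∷ rs) (r∉rs ∷ u) (p[r]≡0 ∷ roots) (s≤s |cs|≤|rs|) x =
    trans (cong (c +_) x*p[x]≡r*p[r]) p[r]≡0
    where
    q[x]≡0 : eval (quotient r cs) x ≡ 0#
    q[x]≡0 = vanishes-everywhere (quotient r cs) rs u
      (All.zipWith (λ (r≢t , p[t]≡0) → quotient-root {cs = cs} p[r]≡0 p[t]≡0 r≢t) (r∉rs , roots))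
      (subst (_≤ length rs) (sym (length-quotient r cs)) |cs|≤|rs|) x
    x*p[x]≡r*p[r] : x * eval cs x ≡ r * eval cs r
    x*p[x]≡r*p[r] = begin
      x * eval cs x                                    ≡⟨ sym (+-identityʳ _) ⟩
      x * eval cs x + 0#                               ≡⟨ cong (x * eval cs x +_) (sym (trans (cong (r *_) q[x]≡0) (zeroʳ r))) ⟩
      x * eval cs x + r * eval (quotient r cs) x       ≡⟨ *-eval-quotient r cs x ⟩
      r * eval cs r + x * eval (quotient r cs) x       ≡⟨ cong (r * eval cs r +_) (trans (cong (x *_) q[x]≡0) (zeroʳ x)) ⟩
      r * eval cs r + 0#                               ≡⟨ +-identityʳ _ ⟩
      r * eval cs r                                    ∎

module FiniteFieldProperties (F : FiniteField) where

  open FiniteField F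

  private
    R : CommutativeRing 0ℓ 0ℓ
    R = record { isCommutativeRing = isCommutativeRing }
    open CommutativeRing R using (+-identityˡ; +-identityʳ; -‿inverseˡ; -‿inverseʳ; *-assoc; *-comm;
      *-identityˡ; *-identityʳ; zeroˡ; zeroʳ; distribˡ; +-group; ring; semiring; commutativeSemiring;
      +-isCommutativeMonoid; *-isCommutativeMonoid)
    open GroupProperties +-group using (inverseʳ-unique; \\-leftDividesˡ; \\-leftDividesʳ) renaming (∙-cancelʳ to +-cancelʳ)
    open ExpProperties commutativeSemiring using (^-homo-*; ^-assocʳ; ^-distrib-*) renaming (_^_ to _^ᴿ_)
    open MultProperties semiring using (×1-homo-*) renaming (_×_ to _×ᴿ_)
    open NaturalCoefficientsSolver commutativeSemiring (λ _ _ → nothing) using (solve; _:=_; _:+_; _:*_; con)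
    open RingProperties ring using (-1*x≈-x)
    open import Data.List.Membership.DecPropositional _≟_ using (_∈?_)
    open ≡-Reasoning

  x⁻¹*x≡1 : ∀ {x} → x ≢ 0# → x ⁻¹ * x ≡ 1#
  x⁻¹*x≡1 {x} x≢0 = trans (*-comm (x ⁻¹) x) (inverse x x≢0)

  x⁻¹*[x*y]≡y : ∀ {x} y → x ≢ 0# → x ⁻¹ * (x * y) ≡ y
  x⁻¹*[x*y]≡y {x} y x≢0 = trans (sym (*-assoc _ _ _)) (trans (cong (_* y) (x⁻¹*x≡1 x≢0)) (*-identityˡ y))

  x*[x⁻¹*y]≡y : ∀ {x} y → x ≢ 0# → x * (x ⁻¹ * y) ≡ y
  x*[x⁻¹*y]≡y {x} y x≢0 = trans (sym (*-assoc _ _ _)) (trans (cong (_* y) (inverse x x≢0)) (*-identityˡ y))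

  *-cancelˡ : ∀ {x y z} → x ≢ 0# → x * y ≡ x * z → y ≡ z
  *-cancelˡ {x} {y} {z} x≢0 xy≡xz = trans (sym (x⁻¹*[x*y]≡y y x≢0)) (trans (cong (x ⁻¹ *_) xy≡xz) (x⁻¹*[x*y]≡y z x≢0))

  noZeroDivisors : ∀ {x y} → x * y ≡ 0# → x ≡ 0# ⊎ y ≡ 0#
  noZeroDivisors {x} {y} xy≡0 with x ≟ 0#
  ... | yes x≡0 = inj₁ x≡0
  ... | no x≢0 = inj₂ (trans (sym (x⁻¹*[x*y]≡y y x≢0)) (trans (cong (x ⁻¹ *_) xy≡0) (zeroʳ _)))

  open Polynomial isCommutativeRing noZeroDivisors using (eval; vanishes-everywhere; *-cancelʳ-≢)

  *-≢0 : ∀ {x y} → x ≢ 0# → y ≢ 0# → x * y ≢ 0#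
  *-≢0 x≢0 y≢0 xy≡0 = [ x≢0 , y≢0 ] (noZeroDivisors xy≡0)

  1≢0 : 1# ≢ 0#
  1≢0 1≡0 = 0≢1 (sym 1≡0)

  ⁻¹-≢0 : ∀ {x} → x ≢ 0# → x ⁻¹ ≢ 0#
  ⁻¹-≢0 {x} x≢0 x⁻¹≡0 = 0≢1 (trans (sym (zeroʳ x)) (trans (cong (x *_) (sym x⁻¹≡0)) (inverse x x≢0)))

  -1≢0 : - 1# ≢ 0#
  -1≢0 -1≡0 = 0≢1 (trans (sym (-‿inverseʳ 1#)) (trans (cong (1# +_) -1≡0) (+-identityʳ 1#)))

  *≡-1⇒≡-⁻¹ : ∀ {x y} → x * y ≡ - 1# → x ≡ - (y ⁻¹)
  *≡-1⇒≡-⁻¹ {x} {y} xy≡-1 = begin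
    x                 ≡⟨ sym (x*[x⁻¹*y]≡y x y≢0) ⟩
    y * (y ⁻¹ * x)    ≡⟨ solve 3 (λ x y z → y :* (z :* x) := x :* y :* z) refl x y (y ⁻¹) ⟩
    x * y * y ⁻¹      ≡⟨ cong (_* y ⁻¹) xy≡-1 ⟩
    - 1# * y ⁻¹       ≡⟨ -1*x≈-x (y ⁻¹) ⟩
    - (y ⁻¹)          ∎
    where
    y≢0 : y ≢ 0#
    y≢0 y≡0 = -1≢0 (trans (sym xy≡-1) (trans (cong (x *_) y≡0) (zeroʳ x)))

  -- the library's _^ᴿ_ unfolds like _^_ but is a different function; rewriting along ^≡^ᴿ transfers its laws
  ^≡^ᴿ : ∀ x n → x ^ n ≡ x ^ᴿ n
  ^≡^ᴿ x zero = refl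
  ^≡^ᴿ x (suc n) = cong (x *_) (^≡^ᴿ x n)

  ^-+ : ∀ x m n → x ^ (m ℕ.+ n) ≡ x ^ m * x ^ n
  ^-+ x m n rewrite ^≡^ᴿ x (m ℕ.+ n) | ^≡^ᴿ x m | ^≡^ᴿ x n = ^-homo-* x m n

  ^-* : ∀ x m n → x ^ (m ℕ.* n) ≡ (x ^ m) ^ n
  ^-* x m n rewrite ^≡^ᴿ (x ^ m) n | ^≡^ᴿ x m | ^≡^ᴿ x (m ℕ.* n) = sym (^-assocʳ x m n)

  *-^ : ∀ x y n → (x * y) ^ n ≡ x ^ n * y ^ n
  *-^ x y n rewrite ^≡^ᴿ (x * y) n | ^≡^ᴿ x n | ^≡^ᴿ y n = ^-distrib-* x y n

  1^ : ∀ n → 1# ^ n ≡ 1#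
  1^ zero = refl
  1^ (suc n) = trans (*-identityˡ _) (1^ n)

  0^ : ∀ n .{{_ : NonZero n}} → 0# ^ n ≡ 0#
  0^ (suc n) = zeroˡ _

  ^-≢0 : ∀ {x} n → x ≢ 0# → x ^ n ≢ 0#
  ^-≢0 zero x≢0 = 1≢0
  ^-≢0 (suc n) x≢0 = *-≢0 x≢0 (^-≢0 n x≢0)

  ι≡×1 : ∀ n → ι n ≡ n ×ᴿ 1#
  ι≡×1 zero = refl
  ι≡×1 (suc n) = cong (1# +_) (ι≡×1 n)

  ι-* : ∀ m n → ι (m ℕ.* n) ≡ ι m * ι n
  ι-* m n rewrite ι≡×1 (m ℕ.* n) | ι≡×1 m | ι≡×1 n = ×1-homo-* m n

  monomial : ℕ → List Carrier
  monomial zero = 1# ∷ []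
  monomial (suc e) = 0# ∷ monomial e

  eval-monomial : ∀ e x → eval (monomial e) x ≡ x ^ e
  eval-monomial zero x = trans (cong (1# +_) (zeroʳ x)) (+-identityʳ 1#)
  eval-monomial (suc e) x = trans (+-identityˡ _) (cong (x *_) (eval-monomial e x))

  length-monomial : ∀ e → length (monomial e) ≡ suc e
  length-monomial zero = refl
  length-monomial (suc e) = cong suc (length-monomial e)

  -- with more than k roots X ^ k - 1 would vanish everywhere, but it is -1 at 0
  roots-of-unity-bound : ∀ k .{{_ : NonZero k}} {zs} → Unique zs → All (λ z → z ^ k ≡ 1#) zs → length zs ≤ k
  roots-of-unity-bound (suc e) {zs} u roots with length zs ℕ.≤? suc e
  ... | yes |zs|≤k = |zs|≤k
  ... | no |zs|≰k = ⊥-elim (-1≢0 (begin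
    - 1#                              ≡⟨ sym (trans (cong (- 1# +_) (zeroˡ _)) (+-identityʳ _)) ⟩
    eval (- 1# ∷ monomial e) 0#        ≡⟨ vanishes-everywhere (- 1# ∷ monomial e) zs u (All.map root roots)
                                           (subst (_≤ length zs) (sym (cong suc (length-monomial e))) (ℕ.≰⇒> |zs|≰k)) 0# ⟩
    0#                                ∎))
    where
    root : ∀ {z} → z ^ suc e ≡ 1# → eval (- 1# ∷ monomial e) z ≡ 0#
    root {z} z^k≡1 = trans (cong (λ t → - 1# + z * t) (eval-monomial e z)) (trans (cong (- 1# +_) z^k≡1) (-‿inverseˡ 1#))

  ^-*-≡1 : ∀ {z a} k → z ^ a ≡ 1# → z ^ (k ℕ.* a) ≡ 1#
  ^-*-≡1 {z} {a} k z^a≡1 = trans (cong (z ^_) (ℕ.*-comm k a)) (trans (^-* z a k) (trans (cong (_^ k) z^a≡1) (1^ k)))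

  ^-+-≡1 : ∀ {z} b c → z ^ c ≡ 1# → z ^ (b ℕ.+ c) ≡ 1# → z ^ b ≡ 1#
  ^-+-≡1 {z} b c z^c≡1 z^b+c≡1 = begin
    z ^ b             ≡⟨ sym (*-identityʳ _) ⟩
    z ^ b * 1#        ≡⟨ cong (z ^ b *_) (sym z^c≡1) ⟩
    z ^ b * z ^ c     ≡⟨ sym (^-+ z b c) ⟩
    z ^ (b ℕ.+ c)     ≡⟨ z^b+c≡1 ⟩
    1#                ∎

  gcd-root : ∀ {z} m n → z ^ m ≡ 1# → z ^ n ≡ 1# → z ^ gcd m n ≡ 1#
  gcd-root {z} m n z^m≡1 z^n≡1 with Bézout.identity (gcd-GCD m n)
  ... | Bézout.+- x y d+y*n≡x*m =
    ^-+-≡1 (gcd m n) (y ℕ.* n) (^-*-≡1 y z^n≡1) (trans (cong (z ^_) d+y*n≡x*m) (^-*-≡1 x z^m≡1))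
  ... | Bézout.-+ x y d+x*m≡y*n =
    ^-+-≡1 (gcd m n) (x ℕ.* m) (^-*-≡1 x z^m≡1) (trans (cong (z ^_) d+x*m≡y*n) (^-*-≡1 y z^n≡1))

  *-root : ∀ {x y} k → x ^ k ≡ 1# → y ^ k ≡ 1# → (x * y) ^ k ≡ 1#
  *-root {x} {y} k x^k≡1 y^k≡1 = trans (*-^ x y k) (trans (cong₂ _*_ x^k≡1 y^k≡1) (*-identityˡ 1#))

  ⁻¹-root : ∀ {x} k → x ≢ 0# → x ^ k ≡ 1# → (x ⁻¹) ^ k ≡ 1#
  ⁻¹-root {x} k x≢0 x^k≡1 = begin
    (x ⁻¹) ^ k            ≡⟨ sym (*-identityʳ _) ⟩
    (x ⁻¹) ^ k * 1#       ≡⟨ cong ((x ⁻¹) ^ k *_) (sym x^k≡1) ⟩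
    (x ⁻¹) ^ k * x ^ k    ≡⟨ sym (*-^ (x ⁻¹) x k) ⟩
    (x ⁻¹ * x) ^ k        ≡⟨ cong (_^ k) (x⁻¹*x≡1 x≢0) ⟩
    1# ^ k                ≡⟨ 1^ k ⟩
    1#                    ∎

  ∈-elements : ∀ x → x ∈ elements
  ∈-elements x = subst (_∈ elements) (Inverse.strictlyInverseˡ enum x) (∈-map⁺ _ (∈-allFin (Inverse.from enum x)))

  elements-unique : Unique elements
  elements-unique = Unique.map⁺ (Injection.injective (↔⇒↣ enum)) (Unique.allFin⁺ q)

  length-elements : length elements ≡ q
  length-elements = trans (length-map _ (allFin q)) (length-tabulate id)

  units : List Carrier
  units = filter (λ x → ¬? (x ≟ 0#)) elements

  ∈-units⁺ : ∀ {x} → x ≢ 0# → x ∈ units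
  ∈-units⁺ {x} x≢0 = ∈-filter⁺ (λ x → ¬? (x ≟ 0#)) (∈-elements x) x≢0

  ∈-units⁻ : ∀ {x} → x ∈ units → x ≢ 0#
  ∈-units⁻ x∈units = proj₂ (∈-filter⁻ (λ x → ¬? (x ≟ 0#)) {xs = elements} x∈units)

  units-unique : Unique units
  units-unique = Unique.filter⁺ (λ x → ¬? (x ≟ 0#)) elements-unique

  N : ℕ
  N = length units

  elements↭0∷units : elements ↭ 0# ∷ units
  elements↭0∷units = unique∧set⇒↭ elements-unique (All.tabulate (λ x∈ 0≡x → ∈-units⁻ x∈ (sym 0≡x)) ∷ units-unique)
    (mk⇔ (λ _ → split _) (λ _ → ∈-elements _))
    where
    split : ∀ x → x ∈ 0# ∷ units
    split x with x ≟ 0#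
    ... | yes x≡0 = here x≡0
    ... | no x≢0 = there (∈-units⁺ x≢0)

  q≡1+N : q ≡ suc N
  q≡1+N = trans (sym length-elements) (↭-length elements↭0∷units)

  q∸1≡N : q ∸ 1 ≡ N
  q∸1≡N = cong (_∸ 1) q≡1+N

  instance
    N-nonZero : NonZero N
    N-nonZero = >-nonZero (∈-length (∈-units⁺ 1≢0))

  map-*-↭ : ∀ {x xs} → x ≢ 0# → (∀ {y} → y ∈ xs → x * y ∈ xs) → (∀ {y} → y ∈ xs → x ⁻¹ * y ∈ xs) →
            Unique xs → map (x *_) xs ↭ xs
  map-*-↭ {x} x≢0 = map-bijection-↭ (x *_) (x ⁻¹ *_) (λ y → x⁻¹*[x*y]≡y y x≢0) (λ y → x*[x⁻¹*y]≡y y x≢0)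

  ∑ ∏ : List Carrier → Carrier
  ∑ = foldr _+_ 0#
  ∏ = foldr _*_ 1#

  ∑-↭ : ∀ {xs ys} → xs ↭ ys → ∑ xs ≡ ∑ ys
  ∑-↭ xs↭ys = foldr-commMonoid (setoid Carrier) +-isCommutativeMonoid (↭⇒↭ₛ xs↭ys)

  ∏-↭ : ∀ {xs ys} → xs ↭ ys → ∏ xs ≡ ∏ ys
  ∏-↭ xs↭ys = foldr-commMonoid (setoid Carrier) *-isCommutativeMonoid (↭⇒↭ₛ xs↭ys)

  ∑-map-* : ∀ x xs → ∑ (map (x *_) xs) ≡ x * ∑ xs
  ∑-map-* x [] = sym (zeroʳ x)
  ∑-map-* x (y ∷ ys) = trans (cong (x * y +_) (∑-map-* x ys)) (sym (distribˡ x y (∑ ys)))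

  ∑-map-1+ : ∀ xs → ∑ (map (1# +_) xs) ≡ ι (length xs) + ∑ xs
  ∑-map-1+ [] = sym (+-identityʳ 0#)
  ∑-map-1+ (y ∷ ys) = trans (cong ((1# + y) +_) (∑-map-1+ ys))
    (solve 3 (λ y i s → con 1 :+ y :+ (i :+ s) := con 1 :+ i :+ (y :+ s)) refl y (ι (length ys)) (∑ ys))

  ∑-map-affine : ∀ a b xs → ∑ (map (λ y → a * y + b) xs) ≡ a * ∑ xs + ι (length xs) * b
  ∑-map-affine a b [] = sym (trans (cong₂ _+_ (zeroʳ a) (zeroˡ b)) (+-identityʳ 0#))
  ∑-map-affine a b (y ∷ ys) = trans (cong ((a * y + b) +_) (∑-map-affine a b ys))
    (solve 5 (λ a b y s i → a :* y :+ b :+ (a :* s :+ i :* b) := a :* (y :+ s) :+ (con 1 :+ i) :* b)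
      refl a b y (∑ ys) (ι (length ys)))

  ∏-map-* : ∀ x xs → ∏ (map (x *_) xs) ≡ x ^ length xs * ∏ xs
  ∏-map-* x [] = sym (*-identityˡ 1#)
  ∏-map-* x (y ∷ ys) = trans (cong ((x * y) *_) (∏-map-* x ys))
    (solve 4 (λ x y p r → x :* y :* (p :* r) := x :* p :* (y :* r)) refl x y (x ^ length ys) (∏ ys))

  ∏-≢0 : ∀ {xs} → All (_≢ 0#) xs → ∏ xs ≢ 0#
  ∏-≢0 [] = 1≢0
  ∏-≢0 (x≢0 ∷ xs≢0) = *-≢0 x≢0 (∏-≢0 xs≢0)

  units-≢0 : All (_≢ 0#) units
  units-≢0 = All.tabulate ∈-units⁻

  fermat : ∀ {x} → x ≢ 0# → x ^ N ≡ 1#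
  fermat {x} x≢0 = *-cancelˡ (∏-≢0 units-≢0) (begin
    ∏ units * x ^ N           ≡⟨ *-comm _ _ ⟩
    x ^ N * ∏ units           ≡⟨ sym (∏-map-* x units) ⟩
    ∏ (map (x *_) units)      ≡⟨ ∏-↭ (map-*-↭ x≢0 (λ y∈ → ∈-units⁺ (*-≢0 x≢0 (∈-units⁻ y∈)))
                                   (λ y∈ → ∈-units⁺ (*-≢0 (⁻¹-≢0 x≢0) (∈-units⁻ y∈))) units-unique) ⟩
    ∏ units                   ≡⟨ sym (*-identityʳ _) ⟩
    ∏ units * 1#              ∎)

  ι-q≡0 : ι q ≡ 0#
  ι-q≡0 = +-cancelʳ (∑ elements) (ι q) 0# (begin
    ι q + ∑ elements                      ≡⟨ cong (λ n → ι n + ∑ elements) (sym length-elements) ⟩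
    ι (length elements) + ∑ elements      ≡⟨ sym (∑-map-1+ elements) ⟩
    ∑ (map (1# +_) elements)              ≡⟨ ∑-↭ (map-bijection-↭ (1# +_) (- 1# +_) (\\-leftDividesʳ 1#) (\\-leftDividesˡ 1#)
                                               (λ _ → ∈-elements _) (λ _ → ∈-elements _) elements-unique) ⟩
    ∑ elements                            ≡⟨ sym (+-identityˡ _) ⟩
    0# + ∑ elements                       ∎)

  ι-N≡-1 : ι N ≡ - 1#
  ι-N≡-1 = inverseʳ-unique 1# (ι N) (trans (cong ι (sym q≡1+N)) ι-q≡0)

  powers : ℕ → List Carrier
  powers n = deduplicate _≟_ (map (_^ n) units)

  powers-unique : ∀ n → Unique (powers n)
  powers-unique n = deduplicate-! _≟_ (map (_^ n) units)

  ∈-powers⁺ : ∀ {x} n → x ≢ 0# → x ^ n ∈ powers n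
  ∈-powers⁺ n x≢0 = ∈-deduplicate⁺ _≟_ (∈-map⁺ (_^ n) (∈-units⁺ x≢0))

  ∈-powers⁻ : ∀ {y} n → y ∈ powers n → ∃ λ x → x ≢ 0# × x ^ n ≡ y
  ∈-powers⁻ n y∈ with ∈-map⁻ (_^ n) (∈-deduplicate⁻ _≟_ (map (_^ n) units) y∈)
  ... | x , x∈units , refl = x , ∈-units⁻ x∈units , refl

  powers-≢0 : ∀ {y} n → y ∈ powers n → y ≢ 0#
  powers-≢0 n y∈ with ∈-powers⁻ n y∈
  ... | x , x≢0 , refl = ^-≢0 n x≢0

  *-invariant⇒∑≡0 : ∀ {h xs} → Unique xs → h ≢ 0# → h ≢ 1# →
                 (∀ {y} → y ∈ xs → h * y ∈ xs) → (∀ {y} → y ∈ xs → h ⁻¹ * y ∈ xs) → ∑ xs ≡ 0#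
  *-invariant⇒∑≡0 {h} {xs} u h≢0 h≢1 *-closed ⁻¹*-closed = *-cancelʳ-≢ (begin
    h * ∑ xs              ≡⟨ sym (∑-map-* h xs) ⟩
    ∑ (map (h *_) xs)     ≡⟨ ∑-↭ (map-*-↭ h≢0 *-closed ⁻¹*-closed u) ⟩
    ∑ xs                  ≡⟨ sym (*-identityˡ _) ⟩
    1# * ∑ xs             ∎) h≢1

  module PowerMap (n : ℕ) where

    d : ℕ
    d = gcd n N

    open _∣_ (gcd[m,n]∣n n N) public using () renaming (quotient to m; equality to N≡m*d)
    open _∣_ (gcd[m,n]∣m n N) using () renaming (quotient to k; equality to n≡k*d)

    instance
      d-nonZero : NonZero d
      d-nonZero = ≢-nonZero (gcd[m,n]≢0 n N (inj₂ (≢-nonZero⁻¹ N)))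

      m-nonZero : NonZero m
      m-nonZero = ≢-nonZero λ m≡0 → ≢-nonZero⁻¹ N (trans N≡m*d (cong (ℕ._* d) m≡0))

    n*m≡k*N : n ℕ.* m ≡ k ℕ.* N
    n*m≡k*N = begin
      n ℕ.* m            ≡⟨ cong (ℕ._* m) n≡k*d ⟩
      k ℕ.* d ℕ.* m      ≡⟨ ℕ.*-assoc k d m ⟩
      k ℕ.* (d ℕ.* m)    ≡⟨ cong (k ℕ.*_) (trans (ℕ.*-comm d m) (sym N≡m*d)) ⟩
      k ℕ.* N            ∎

    powers-roots : ∀ {y} → y ∈ powers n → y ^ m ≡ 1#
    powers-roots y∈ with ∈-powers⁻ n y∈
    ... | x , x≢0 , refl = trans (sym (^-* x n m)) (trans (cong (x ^_) n*m≡k*N) (^-*-≡1 k (fermat x≢0)))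

    -- x ↦ x * x₀⁻¹ maps the fibre through x₀ injectively into the d-th roots of unity
    fibre-bound : ∀ y {E} → Unique E → All (_≢ 0#) E → All (λ x → x ^ n ≡ y) E → length E ≤ d
    fibre-bound y {[]} _ _ _ = z≤n
    fibre-bound y {x₀ ∷ E} u E≢0@(x₀≢0 ∷ _) E↦y@(x₀^n≡y ∷ _) =
      subst (_≤ d) (length-map (_* x₀ ⁻¹) (x₀ ∷ E))
        (roots-of-unity-bound d (Unique.map⁺ (λ e → *-cancelˡ (⁻¹-≢0 x₀≢0) (trans (*-comm _ _) (trans e (*-comm _ _)))) u)
          (All.map⁺ (All.zipWith quotient-root (E≢0 , E↦y))))
      where
      x₀⁻¹^n*y≡1 : (x₀ ⁻¹) ^ n * y ≡ 1#
      x₀⁻¹^n*y≡1 = begin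
        (x₀ ⁻¹) ^ n * y         ≡⟨ cong ((x₀ ⁻¹) ^ n *_) (sym x₀^n≡y) ⟩
        (x₀ ⁻¹) ^ n * x₀ ^ n    ≡⟨ sym (*-^ (x₀ ⁻¹) x₀ n) ⟩
        (x₀ ⁻¹ * x₀) ^ n        ≡⟨ cong (_^ n) (x⁻¹*x≡1 x₀≢0) ⟩
        1# ^ n                  ≡⟨ 1^ n ⟩
        1#                      ∎
      quotient-root : ∀ {x} → x ≢ 0# × x ^ n ≡ y → (x * x₀ ⁻¹) ^ d ≡ 1#
      quotient-root {x} (x≢0 , x^n≡y) = gcd-root n N
        (trans (*-^ x (x₀ ⁻¹) n) (trans (cong (_* (x₀ ⁻¹) ^ n) x^n≡y) (trans (*-comm _ _) x₀⁻¹^n*y≡1)))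
        (fermat (*-≢0 x≢0 (⁻¹-≢0 x₀≢0)))

    length-powers : length (powers n) ≡ m
    length-powers = ℕ.≤-antisym
      (roots-of-unity-bound m (powers-unique n) (All.tabulate powers-roots))
      (ℕ.*-cancelʳ-≤ m (length (powers n)) d (subst (ℕ._≤ length (powers n) ℕ.* d) N≡m*d
        (length≤fibres _≟_ (_^ n) d fibre-bound (powers n) units-unique units-≢0
          (All.tabulate (λ x∈ → ∈-powers⁺ n (∈-units⁻ x∈))))))

    root-∈-powers : ∀ {y} → y ^ m ≡ 1# → y ∈ powers n
    root-∈-powers {y} y^m≡1 with y ∈? powers n
    ... | yes y∈ = y∈
    ... | no y∉ = ⊥-elim (ℕ.<-irrefl length-powers
      (roots-of-unity-bound m (All.tabulate (λ z∈ y≡z → y∉ (subst (_∈ powers n) (sym y≡z) z∈)) ∷ powers-unique n)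
        (y^m≡1 ∷ All.tabulate powers-roots)))

  ∈-valueSet : ∀ f x → f x ∈ valueSet f
  ∈-valueSet f x = ∈-deduplicate⁺ _≟_ (∈-map⁺ f (∈-elements x))

  ∈-valueSet⁻ : ∀ f {z} → z ∈ valueSet f → ∃ λ x → z ≡ f x
  ∈-valueSet⁻ f z∈ with ∈-map⁻ f (∈-deduplicate⁻ _≟_ (map f elements) z∈)
  ... | x , _ , z≡fx = x , z≡fx

  module _ (n : ℕ) .{{_ : NonZero n}} {a : Carrier} (b : Carrier) (a≢0 : a ≢ 0#) where

    valueSet-affine-power : valueSet (λ x → a * x ^ n + b) ↭ b ∷ map (λ y → a * y + b) (powers n)
    valueSet-affine-power = unique∧set⇒↭ (deduplicate-! _≟_ _)
      (All.map⁺ (All.tabulate b≢ay+b) ∷ Unique.map⁺ affine-injective (powers-unique n)) (mk⇔ to from)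
      where
      f[0]≡b : a * 0# ^ n + b ≡ b
      f[0]≡b = trans (cong (λ t → a * t + b) (0^ n)) (trans (cong (_+ b) (zeroʳ a)) (+-identityˡ b))
      b≢ay+b : ∀ {y} → y ∈ powers n → b ≢ a * y + b
      b≢ay+b y∈ b≡ay+b = *-≢0 a≢0 (powers-≢0 n y∈) (+-cancelʳ b _ _ (trans (sym b≡ay+b) (sym (+-identityˡ b))))
      affine-injective : ∀ {y z} → a * y + b ≡ a * z + b → y ≡ z
      affine-injective ay+b≡az+b = *-cancelˡ a≢0 (+-cancelʳ b _ _ ay+b≡az+b)
      to : ∀ {z} → z ∈ valueSet (λ x → a * x ^ n + b) → z ∈ b ∷ map (λ y → a * y + b) (powers n)
      to z∈ with ∈-valueSet⁻ _ z∈
      ... | x , refl with x ≟ 0#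
      ...   | yes refl = here f[0]≡b
      ...   | no x≢0 = there (∈-map⁺ _ (∈-powers⁺ n x≢0))
      from : ∀ {z} → z ∈ b ∷ map (λ y → a * y + b) (powers n) → z ∈ valueSet (λ x → a * x ^ n + b)
      from (here refl) = subst (_∈ valueSet (λ x → a * x ^ n + b)) f[0]≡b (∈-valueSet (λ x → a * x ^ n + b) 0#)
      from (there z∈) with ∈-map⁻ _ z∈
      ... | y , y∈ , refl with ∈-powers⁻ n y∈
      ...   | x , _ , refl = ∈-valueSet _ x

    S-affine-power : S (λ x → a * x ^ n + b) ≡ b + (a * ∑ (powers n) + ι (length (powers n)) * b)
    S-affine-power = trans (∑-↭ valueSet-affine-power) (cong (b +_) (∑-map-affine a b (powers n)))

    S-affine-power-multiple : N ∣ n → S (λ x → a * x ^ n + b) ≡ a + ι 2 * b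
    S-affine-power-multiple N∣n = begin
      S (λ x → a * x ^ n + b)                                ≡⟨ S-affine-power ⟩
      b + (a * ∑ (powers n) + ι (length (powers n)) * b)     ≡⟨ cong₂ (λ s l → b + (a * s + ι l * b))
                                                                   (∑-↭ powers↭[1]) (↭-length powers↭[1]) ⟩
      b + (a * (1# + 0#) + (1# + 0#) * b)                    ≡⟨ solve 2 (λ a b → b :+ (a :* (con 1 :+ con 0) :+ (con 1 :+ con 0) :* b)
                                                                              := a :+ (con 1 :+ (con 1 :+ con 0)) :* b) refl a b ⟩
      a + ι 2 * b                                            ∎
      where
      powers↭[1] : powers n ↭ 1# ∷ []
      powers↭[1] = unique∧set⇒↭ (powers-unique n) ([] ∷ []) (mk⇔ to from)
        where
        to : ∀ {y} → y ∈ powers n → y ∈ 1# ∷ []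
        to y∈ with ∈-powers⁻ n y∈
        ... | x , x≢0 , refl = here (trans (cong (x ^_) (_∣_.equality N∣n)) (^-*-≡1 (_∣_.quotient N∣n) (fermat x≢0)))
        from : ∀ {y} → y ∈ 1# ∷ [] → y ∈ powers n
        from (here refl) = subst (_∈ powers n) (1^ n) (∈-powers⁺ n 1≢0)

    S-affine-power-non-multiple : ¬ N ∣ n → S (λ x → a * x ^ n + b) ≡ b * (1# - ι (gcd n N) ⁻¹)
    S-affine-power-non-multiple N∤n = begin
      S (λ x → a * x ^ n + b)                                ≡⟨ S-affine-power ⟩
      b + (a * ∑ (powers n) + ι (length (powers n)) * b)     ≡⟨ cong₂ (λ s l → b + (a * s + ι l * b)) ∑-powers≡0 length-powers ⟩
      b + (a * 0# + ι m * b)                                 ≡⟨ cong₂ (λ s t → b + (s + t * b)) (zeroʳ a) ι-m≡-ι-d⁻¹ ⟩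
      b + (0# + - (ι d ⁻¹) * b)                              ≡⟨ cong (b +_) (+-identityˡ _) ⟩
      b + - (ι d ⁻¹) * b                                     ≡⟨ solve 2 (λ b t → b :+ t :* b := b :* (con 1 :+ t)) refl b (- (ι d ⁻¹)) ⟩
      b * (1# - ι d ⁻¹)                                      ∎
      where
      open PowerMap n
      2≤m : 2 ≤ m
      2≤m = ℕ.≤∧≢⇒< (ℕ.>-nonZero⁻¹ m) λ 1≡m →
        N∤n (subst (_∣ n) (sym (trans N≡m*d (trans (cong (ℕ._* d) (sym 1≡m)) (ℕ.*-identityˡ d)))) (gcd[m,n]∣m n N))
      ∑-powers≡0 : ∑ (powers n) ≡ 0#
      ∑-powers≡0 with ∃-∈-≢ _≟_ 1# (powers-unique n) (subst (2 ≤_) (sym length-powers) 2≤m)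
      ... | h , h∈ , h≢1 = *-invariant⇒∑≡0 (powers-unique n) (powers-≢0 n h∈) h≢1
        (λ y∈ → root-∈-powers (*-root m (powers-roots h∈) (powers-roots y∈)))
        (λ y∈ → root-∈-powers (*-root m (⁻¹-root m (powers-≢0 n h∈) (powers-roots h∈)) (powers-roots y∈)))
      ι-m≡-ι-d⁻¹ : ι m ≡ - (ι d ⁻¹)
      ι-m≡-ι-d⁻¹ = *≡-1⇒≡-⁻¹ (trans (sym (ι-* m d)) (trans (cong ι (sym N≡m*d)) ι-N≡-1))

proposition1p6 : (F : FiniteField) → let open FiniteField F in
    (n : ℕ) → .{{_ : NonZero n}} → (a b : Carrier) → ¬ (a ≡ 0#) →
      ((q ∸ 1) ∣ n → S (λ x → a * (x ^ n) + b) ≡ a + ι 2 * b)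
      × (¬ ((q ∸ 1) ∣ n) → S (λ x → a * (x ^ n) + b) ≡ b * (1# - ((ι (gcd n (q ∸ 1))) ⁻¹)))
proposition1p6 F n a b a≢0 rewrite FiniteFieldProperties.q∸1≡N F =
  S-affine-power-multiple n b a≢0 , S-affine-power-non-multiple n b a≢0
  where open FiniteFieldProperties F
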